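{- Let $n$ be a positive integer. Then $$\sum_{m=0}^{n}(-1)^m\binom{n-1}{n-m}\frac{n!}{2^m}=\sum_{m=0}^{n+1}(-1)^{m+n}S_1(n,m)E_m.$$
   Context: The (signed) Stirling numbers of the first kind $S_1(n,m)$ are defined by $x(x-1)\cdots(x-n+1)=\sum_{m=0}^nS_1(n,m)x^m$, with $S_1(n,m)=0$ for $m>n$. The Euler numbers $E_m$ are defined by $\frac{2}{e^t+1}=\sum_{m\ge0}E_m\frac{t^m}{m!}$ (so $E_0=1$, $E_1=-\tfrac12$). $\binom{a}{b}=0$ if $b>a$. -}

module Defs where

open import Data.Nat as ℕ using (ℕ; zero; suc; _≤ᵇ_)
open import Data.Nat.Combinatorics using (_C_)
open import Data.Integer as ℤ using (ℤ; +_)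
open import Data.Rational using (ℚ; _+_; _*_; -_; _/_; 0ℚ; 1ℚ)
open import Data.Bool using (if_then_else_)

sumTo : ℕ → (ℕ → ℚ) → ℚ
sumTo zero    f = f 0
sumTo (suc n) f = sumTo n f + f (suc n)

_^ℚ_ : ℚ → ℕ → ℚ
q ^ℚ zero  = 1ℚ
q ^ℚ suc k = q * (q ^ℚ k)

sgn : ℕ → ℚ
sgn k = (- 1ℚ) ^ℚ k

ℕtoℚ : ℕ → ℚ
ℕtoℚ n = (+ n) / 1

ℤtoℚ : ℤ → ℚ
ℤtoℚ z = z / 1

-- Signed Stirling numbers of the first kind:
-- x(x-1)...(x-n+1) = Σ_m S₁ n m x^m, via the recurrence coming from
-- multiplying by (x - n):  S₁(n+1,m+1) = S₁(n,m) - n S₁(n,m+1).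
S₁ : ℕ → ℕ → ℤ
S₁ zero    zero    = + 1
S₁ zero    (suc m) = + 0
S₁ (suc n) zero    = + 0
S₁ (suc n) (suc m) = S₁ n m ℤ.- (+ n) ℤ.* S₁ n (suc m)

-- Euler numbers:  2/(e^t+1) = Σ E_m t^m/m!.
-- Comparing coefficients in (e^t + 1)·Σ E_m t^m/m! = 2 gives
--   E_m + Σ_{k=0}^{m} C(m,k) E_k = 2·[m = 0],
-- i.e. E_0 = 1 and E_m = -(1/2) Σ_{k=0}^{m-1} C(m,k) E_k for m ≥ 1.
-- eulerUpTo m k = E_k for k ≤ m.
eulerUpTo : ℕ → ℕ → ℚ
eulerUpTo zero    k = 1ℚ
eulerUpTo (suc m) k =
  if k ≤ᵇ m then eulerUpTo m k
  else (- ((+ 1) / 2)) * sumTo m (λ j → ℕtoℚ (suc m C j) * eulerUpTo m j)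

E : ℕ → ℚ
E m = eulerUpTo m m

{-# OPTIONS --safe #-}
module Submission where

-- Let 𝓔 be the linear functional on polynomials with 𝓔(xᵏ) = E k. The recurrence defining the
-- Euler numbers says exactly that 𝓔(p(x + 1)) + 𝓔(p(x)) = 2 p(0). Write W(c, n) for 𝓔 of the
-- falling factorial (x + c)ₙ = (x + c)(x + c - 1) ⋯ (x + c - n + 1). The shift identity, the
-- difference equation (x + c + 1)ₙ₊₁ - (x + c)ₙ₊₁ = (n + 1)(x + c)ₙ and the vanishing of (x + j)ₙ
-- at 0 for natural j < n give W(0, n) = (-1)ⁿ n!/2ⁿ and W(j, n) = (-1)ʲ W(0, n) for j ≤ n.
-- The right-hand side is 𝓔 of the rising factorial x(x + 1) ⋯ (x + n - 1) = (x + n - 1)ₙ, hence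
-- W(n - 1, n) = -n!/2ⁿ; the left-hand side is -(n!/2)(1 - 1/2)ⁿ⁻¹ by the binomial theorem.

open import Defs
open import Data.Nat using (ℕ; suc; _∸_; _+_; NonZero; _!)
open import Data.Nat.Combinatorics using (_C_)
open import Data.Rational using (ℚ; _*_; _/_)
open import Data.Integer using (+_)
open import Relation.Binary.PropositionalEquality using (_≡_)

open import Algebra.Bundles using (CommutativeRing)
open import Data.Bool using (true; false)
open import Data.Empty using (⊥-elim)
open import Data.Fin using (toℕ)
import Data.Integer as ℤ
import Data.Integer.Properties as ℤ
open import Data.Nat using (zero; _≤_; _<_; _≤′_; ≤′-refl; ≤′-step; z≤n; s≤s; _≤ᵇ_)
open import Data.Nat using () renaming (_*_ to _*ℕ_)
import Data.Nat.Properties as ℕ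
open import Data.Nat.Combinatorics
  using (nCn≡1; k>n⇒nCk≡0; nCk≡nC[n∸k]; nCk+nC[k+1]≡[n+1]C[k+1])
open import Data.Rational using (0ℚ; 1ℚ; ½; -_; toℚᵘ)
  renaming (_+_ to _+ℚ_; _-_ to _-ℚ_)
open import Data.Rational.Properties
  using ( +-identityˡ; +-identityʳ; +-comm; *-identityˡ; *-identityʳ; *-zeroˡ; *-zeroʳ
        ; +-assoc; *-assoc; *-distribˡ-+; *-distribʳ-+; +-0-group; +-*-commutativeRing
        ; toℚᵘ-injective; toℚᵘ-fromℚᵘ; toℚᵘ-homo-+; toℚᵘ-homo-*; toℚᵘ-homo‿- )
import Data.Rational.Unnormalised as ℚᵘ
import Data.Rational.Unnormalised.Properties as ℚᵘ
open import Data.Rational.Solver using (module +-*-Solver)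
open import Data.Sum using (inj₁; inj₂)
open import Function using (_∘_)
open import Relation.Binary.PropositionalEquality
  using (refl; sym; trans; cong; cong₂; module ≡-Reasoning)

open import Algebra.Properties.Group +-0-group using (inverseˡ-unique)
open CommutativeRing +-*-commutativeRing using (semiring; commutativeSemiring)
open import Algebra.Properties.Semiring.Sum semiring
  using (sum⁺-syntax; ∑-distrib-+; ∑-comm; *-distribˡ-sum; *-distribʳ-sum; sum-cong-≗)
open import Algebra.Properties.CommutativeSemiring.Binomial commutativeSemiring
  using () renaming (theorem to binomialTheorem)
open import Algebra.Properties.Semiring.Exp semiring using (_^_)
open import Algebra.Properties.Semiring.Mult semiring using (_×_)
open +-*-Solver using (solve; _:=_; _:+_; _:*_; _:-_; :-_; con)

toℚᵘ-ℤtoℚ : ∀ i → toℚᵘ (ℤtoℚ i) ℚᵘ.≃ ℚᵘ.mkℚᵘ i 0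
toℚᵘ-ℤtoℚ i = toℚᵘ-fromℚᵘ (ℚᵘ.mkℚᵘ i 0)

ℤtoℚ-+ : ∀ a b → ℤtoℚ (a ℤ.+ b) ≡ ℤtoℚ a +ℚ ℤtoℚ b
ℤtoℚ-+ a b = toℚᵘ-injective (begin
  toℚᵘ (ℤtoℚ (a ℤ.+ b))              ≈⟨ toℚᵘ-ℤtoℚ (a ℤ.+ b) ⟩
  ℚᵘ.mkℚᵘ (a ℤ.+ b) 0                ≈⟨ ℚᵘ.*≡* (cong (ℤ._* + 1) (sym a*1+b*1≡a+b)) ⟩
  ℚᵘ.mkℚᵘ a 0 ℚᵘ.+ ℚᵘ.mkℚᵘ b 0       ≈⟨ ℚᵘ.+-cong (toℚᵘ-ℤtoℚ a) (toℚᵘ-ℤtoℚ b) ⟨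
  toℚᵘ (ℤtoℚ a) ℚᵘ.+ toℚᵘ (ℤtoℚ b)   ≈⟨ toℚᵘ-homo-+ (ℤtoℚ a) (ℤtoℚ b) ⟨
  toℚᵘ (ℤtoℚ a +ℚ ℤtoℚ b)            ∎)
  where
  open ℚᵘ.≃-Reasoning
  a*1+b*1≡a+b : a ℤ.* + 1 ℤ.+ b ℤ.* + 1 ≡ a ℤ.+ b
  a*1+b*1≡a+b = cong₂ ℤ._+_ (ℤ.*-identityʳ a) (ℤ.*-identityʳ b)

ℤtoℚ-* : ∀ a b → ℤtoℚ (a ℤ.* b) ≡ ℤtoℚ a * ℤtoℚ b
ℤtoℚ-* a b = toℚᵘ-injective (begin
  toℚᵘ (ℤtoℚ (a ℤ.* b))              ≈⟨ toℚᵘ-ℤtoℚ (a ℤ.* b) ⟩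
  ℚᵘ.mkℚᵘ (a ℤ.* b) 0                ≈⟨ ℚᵘ.*≡* refl ⟩
  ℚᵘ.mkℚᵘ a 0 ℚᵘ.* ℚᵘ.mkℚᵘ b 0       ≈⟨ ℚᵘ.*-cong (toℚᵘ-ℤtoℚ a) (toℚᵘ-ℤtoℚ b) ⟨
  toℚᵘ (ℤtoℚ a) ℚᵘ.* toℚᵘ (ℤtoℚ b)   ≈⟨ toℚᵘ-homo-* (ℤtoℚ a) (ℤtoℚ b) ⟨
  toℚᵘ (ℤtoℚ a * ℤtoℚ b)             ∎)
  where open ℚᵘ.≃-Reasoning

ℤtoℚ-neg : ∀ a → ℤtoℚ (ℤ.- a) ≡ - ℤtoℚ a
ℤtoℚ-neg a = toℚᵘ-injective (begin
  toℚᵘ (ℤtoℚ (ℤ.- a))         ≈⟨ toℚᵘ-ℤtoℚ (ℤ.- a) ⟩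
  ℚᵘ.mkℚᵘ (ℤ.- a) 0           ≈⟨ ℚᵘ.*≡* refl ⟩
  ℚᵘ.- ℚᵘ.mkℚᵘ a 0            ≈⟨ ℚᵘ.-‿cong (toℚᵘ-ℤtoℚ a) ⟨
  ℚᵘ.- toℚᵘ (ℤtoℚ a)          ≈⟨ toℚᵘ-homo‿- (ℤtoℚ a) ⟨
  toℚᵘ (- ℤtoℚ a)             ∎)
  where open ℚᵘ.≃-Reasoning

ℕtoℚ-+ : ∀ a b → ℕtoℚ (a + b) ≡ ℕtoℚ a +ℚ ℕtoℚ b
ℕtoℚ-+ a b = trans (cong ℤtoℚ (ℤ.pos-+ a b)) (ℤtoℚ-+ (+ a) (+ b))

ℕtoℚ-* : ∀ a b → ℕtoℚ (a *ℕ b) ≡ ℕtoℚ a * ℕtoℚ b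
ℕtoℚ-* a b = trans (cong ℤtoℚ (ℤ.pos-* a b)) (ℤtoℚ-* (+ a) (+ b))

ℕtoℚ-suc : ∀ n → ℕtoℚ (suc n) ≡ 1ℚ +ℚ ℕtoℚ n
ℕtoℚ-suc = ℕtoℚ-+ 1

ℕtoℚ-suc-1 : ∀ n → ℕtoℚ (suc n) -ℚ 1ℚ ≡ ℕtoℚ n
ℕtoℚ-suc-1 n = trans (cong (_-ℚ 1ℚ) (ℕtoℚ-suc n))
                     (solve 1 (λ x → (con 1ℚ :+ x) :- con 1ℚ := x) refl (ℕtoℚ n))

open ≡-Reasoning

sumTo-cong : ∀ n {f g : ℕ → ℚ} → (∀ i → i ≤ n → f i ≡ g i) → sumTo n f ≡ sumTo n g
sumTo-cong zero    f≗g = f≗g 0 z≤n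
sumTo-cong (suc n) f≗g =
  cong₂ _+ℚ_ (sumTo-cong n λ i i≤n → f≗g i (ℕ.m≤n⇒m≤1+n i≤n)) (f≗g (suc n) ℕ.≤-refl)

sumTo-suc : ∀ n (f : ℕ → ℚ) → sumTo (suc n) f ≡ f 0 +ℚ sumTo n (f ∘ suc)
sumTo-suc zero    f = refl
sumTo-suc (suc n) f = begin
  sumTo (suc n) f +ℚ f (suc (suc n))                ≡⟨ cong (_+ℚ f (suc (suc n))) (sumTo-suc n f) ⟩
  (f 0 +ℚ sumTo n (f ∘ suc)) +ℚ f (suc (suc n))    ≡⟨ +-assoc (f 0) _ _ ⟩
  f 0 +ℚ sumTo (suc n) (f ∘ suc)                    ∎

sumTo-extend : ∀ {n N} (f : ℕ → ℚ) → n ≤ N → (∀ i → n < i → f i ≡ 0ℚ) →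
               sumTo N f ≡ sumTo n f
sumTo-extend {n} f n≤N vanish = go (ℕ.≤⇒≤′ n≤N)
  where
  go : ∀ {N} → n ≤′ N → sumTo N f ≡ sumTo n f
  go ≤′-refl             = refl
  go (≤′-step {N} n≤′N) = begin
    sumTo N f +ℚ f (suc N)  ≡⟨ cong₂ _+ℚ_ (go n≤′N) (vanish (suc N) (s≤s (ℕ.≤′⇒≤ n≤′N))) ⟩
    sumTo n f +ℚ 0ℚ         ≡⟨ +-identityʳ (sumTo n f) ⟩
    sumTo n f               ∎

sumTo≡∑ : ∀ n (f : ℕ → ℚ) → sumTo n f ≡ ∑[ i ≤ n ] f (toℕ i)
sumTo≡∑ zero    f = sym (+-identityʳ (f 0))
sumTo≡∑ (suc n) f = trans (sumTo-suc n f) (cong (f 0 +ℚ_) (sumTo≡∑ n (f ∘ suc)))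

sumTo-+ : ∀ n (f g : ℕ → ℚ) → sumTo n (λ i → f i +ℚ g i) ≡ sumTo n f +ℚ sumTo n g
sumTo-+ n f g = begin
  sumTo n (λ i → f i +ℚ g i)                     ≡⟨ sumTo≡∑ n _ ⟩
  ∑[ i ≤ n ] (f (toℕ i) +ℚ g (toℕ i))            ≡⟨ ∑-distrib-+ {suc n} (f ∘ toℕ) (g ∘ toℕ) ⟩
  ∑[ i ≤ n ] f (toℕ i) +ℚ ∑[ i ≤ n ] g (toℕ i)   ≡⟨ cong₂ _+ℚ_ (sumTo≡∑ n f) (sumTo≡∑ n g) ⟨
  sumTo n f +ℚ sumTo n g                         ∎

sumTo-*ˡ : ∀ n c (f : ℕ → ℚ) → c * sumTo n f ≡ sumTo n (λ i → c * f i)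
sumTo-*ˡ n c f = begin
  c * sumTo n f                  ≡⟨ cong (c *_) (sumTo≡∑ n f) ⟩
  c * ∑[ i ≤ n ] f (toℕ i)       ≡⟨ *-distribˡ-sum {suc n} c (f ∘ toℕ) ⟩
  ∑[ i ≤ n ] (c * f (toℕ i))     ≡⟨ sym (sumTo≡∑ n _) ⟩
  sumTo n (λ i → c * f i)        ∎

sumTo-*ʳ : ∀ n c (f : ℕ → ℚ) → sumTo n f * c ≡ sumTo n (λ i → f i * c)
sumTo-*ʳ n c f = begin
  sumTo n f * c                  ≡⟨ cong (_* c) (sumTo≡∑ n f) ⟩
  ∑[ i ≤ n ] f (toℕ i) * c       ≡⟨ *-distribʳ-sum {suc n} c (f ∘ toℕ) ⟩
  ∑[ i ≤ n ] (f (toℕ i) * c)     ≡⟨ sym (sumTo≡∑ n _) ⟩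
  sumTo n (λ i → f i * c)        ∎

sumTo²≡∑∑ : ∀ n m (f : ℕ → ℕ → ℚ) →
            sumTo n (λ i → sumTo m (f i)) ≡ ∑[ i ≤ n ] ∑[ j ≤ m ] f (toℕ i) (toℕ j)
sumTo²≡∑∑ n m f = trans (sumTo≡∑ n _) (sum-cong-≗ {suc n} λ i → sumTo≡∑ m (f (toℕ i)))

sumTo-swap : ∀ n m (f : ℕ → ℕ → ℚ) →
             sumTo n (λ i → sumTo m (f i)) ≡ sumTo m (λ j → sumTo n (λ i → f i j))
sumTo-swap n m f = begin
  sumTo n (λ i → sumTo m (f i))
    ≡⟨ sumTo²≡∑∑ n m f ⟩
  ∑[ i ≤ n ] ∑[ j ≤ m ] f (toℕ i) (toℕ j)
    ≡⟨ ∑-comm {suc n} {suc m} (λ i j → f (toℕ i) (toℕ j)) ⟩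
  ∑[ j ≤ m ] ∑[ i ≤ n ] f (toℕ i) (toℕ j)
    ≡⟨ sumTo²≡∑∑ m n (λ j i → f i j) ⟨
  sumTo m (λ j → sumTo n (λ i → f i j)) ∎

sumTo-linear : ∀ n c (f g w : ℕ → ℚ) →
               sumTo n (λ i → (f i +ℚ c * g i) * w i)
                 ≡ sumTo n (λ i → f i * w i) +ℚ c * sumTo n (λ i → g i * w i)
sumTo-linear n c f g w = begin
  sumTo n (λ i → (f i +ℚ c * g i) * w i)
    ≡⟨ sumTo-cong n (λ i _ → trans (*-distribʳ-+ (w i) (f i) (c * g i))
                                   (cong (f i * w i +ℚ_) (*-assoc c (g i) (w i)))) ⟩
  sumTo n (λ i → f i * w i +ℚ c * (g i * w i))
    ≡⟨ sumTo-+ n _ _ ⟩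
  sumTo n (λ i → f i * w i) +ℚ sumTo n (λ i → c * (g i * w i))
    ≡⟨ cong (sumTo n (λ i → f i * w i) +ℚ_) (sym (sumTo-*ˡ n c _)) ⟩
  sumTo n (λ i → f i * w i) +ℚ c * sumTo n (λ i → g i * w i) ∎

twoIfZero : ℕ → ℚ
twoIfZero zero    = 1ℚ +ℚ 1ℚ
twoIfZero (suc _) = 0ℚ

sumTo-twoIfZero : ∀ n (f : ℕ → ℚ) → sumTo n (λ i → f i * twoIfZero i) ≡ f 0 +ℚ f 0
sumTo-twoIfZero zero    f = solve 1 (λ a → a :* (con 1ℚ :+ con 1ℚ) := a :+ a) refl (f 0)
sumTo-twoIfZero (suc n) f = begin
  sumTo n (λ i → f i * twoIfZero i) +ℚ f (suc n) * 0ℚ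
    ≡⟨ cong₂ _+ℚ_ (sumTo-twoIfZero n f) (*-zeroʳ (f (suc n))) ⟩
  (f 0 +ℚ f 0) +ℚ 0ℚ
    ≡⟨ +-identityʳ _ ⟩
  f 0 +ℚ f 0 ∎

eulerUpTo-stable : ∀ m {k} → k ≤ m → eulerUpTo m k ≡ E k
eulerUpTo-stable zero    z≤n = refl
eulerUpTo-stable (suc m) {k} k≤1+m with ℕ.m≤n⇒m<n∨m≡n k≤1+m
... | inj₂ refl = refl
... | inj₁ (s≤s k≤m) with k ≤ᵇ m | ℕ.≤⇒≤ᵇ k≤m
...   | true | _ = eulerUpTo-stable m k≤m

E-suc : ∀ m → E (suc m) ≡ - ½ * sumTo m (λ j → ℕtoℚ (suc m C j) * E j)
E-suc m with suc m ≤ᵇ m | ℕ.≤ᵇ⇒≤ (suc m) m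
... | true  | 1+m≤m = ⊥-elim (ℕ.<-irrefl refl (1+m≤m _))
... | false | _     =
  cong (- ½ *_) (sumTo-cong m λ j j≤m → cong (ℕtoℚ (suc m C j) *_) (eulerUpTo-stable m j≤m))

E-binomial : ∀ m → sumTo m (λ k → ℕtoℚ (m C k) * E k) +ℚ E m ≡ twoIfZero m
E-binomial zero    = refl
E-binomial (suc m) = begin
  S +ℚ ℕtoℚ (suc m C suc m) * E (suc m) +ℚ E (suc m)
    ≡⟨ cong (λ c → S +ℚ ℕtoℚ c * E (suc m) +ℚ E (suc m)) (nCn≡1 (suc m)) ⟩
  S +ℚ 1ℚ * E (suc m) +ℚ E (suc m)
    ≡⟨ cong (λ e → S +ℚ 1ℚ * e +ℚ e) (E-suc m) ⟩
  S +ℚ 1ℚ * (- ½ * S) +ℚ - ½ * S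
    ≡⟨ solve 1 (λ s → s :+ con 1ℚ :* (:- con ½ :* s) :+ :- con ½ :* s := con 0ℚ) refl S ⟩
  0ℚ ∎
  where S = sumTo m (λ j → ℕtoℚ (suc m C j) * E j)

-- Polynomials, the Taylor shift and the Euler functional

-- Polynomials are coefficient sequences: p k is the coefficient of xᵏ.
Poly : Set
Poly = ℕ → ℚ

DegreeAtMost : ℕ → Poly → Set
DegreeAtMost n p = ∀ k → n < k → p k ≡ 0ℚ

one : Poly
one zero    = 1ℚ
one (suc _) = 0ℚ

timesX : Poly → Poly
timesX p zero    = 0ℚ
timesX p (suc k) = p k

-- linearTimes c p = (x + c) · p
linearTimes : ℚ → Poly → Poly
linearTimes c p zero    = c * p 0
linearTimes c p (suc k) = p k +ℚ c * p (suc k)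

-- The coefficients of p (x + 1), for p of degree at most N.
taylorShift : ℕ → Poly → Poly
taylorShift N p k = sumTo N (λ m → p m * ℕtoℚ (m C k))

eulerFunctional : ℕ → Poly → ℚ
eulerFunctional N p = sumTo N (λ k → p k * E k)

linearTimes-split : ∀ c p k → linearTimes c p k ≡ timesX p k +ℚ c * p k
linearTimes-split c p zero    = sym (+-identityˡ (c * p 0))
linearTimes-split c p (suc k) = refl

linearTimes-cong : ∀ c {p q} → (∀ i → p i ≡ q i) → ∀ k → linearTimes c p k ≡ linearTimes c q k
linearTimes-cong c p≗q zero    = cong (c *_) (p≗q 0)
linearTimes-cong c p≗q (suc k) = cong₂ (λ a b → a +ℚ c * b) (p≗q k) (p≗q (suc k))

linearTimes-+ : ∀ c d p k → linearTimes (c +ℚ d) p k ≡ linearTimes c p k +ℚ d * p k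
linearTimes-+ c d p zero    = *-distribʳ-+ (p 0) c d
linearTimes-+ c d p (suc k) =
  solve 4 (λ a c d b → a :+ (c :+ d) :* b := (a :+ c :* b) :+ d :* b) refl (p k) c d (p (suc k))

linearTimes-comm : ∀ a b p k → linearTimes a (linearTimes b p) k ≡ linearTimes b (linearTimes a p) k
linearTimes-comm a b p zero          =
  solve 3 (λ a b x → a :* (b :* x) := b :* (a :* x)) refl a b (p 0)
linearTimes-comm a b p (suc zero)    =
  solve 4 (λ a b x y → b :* x :+ a :* (x :+ b :* y) := a :* x :+ b :* (x :+ a :* y)) refl a b (p 0) (p 1)
linearTimes-comm a b p (suc (suc k)) =
  solve 5 (λ a b x y z → (x :+ b :* y) :+ a :* (y :+ b :* z) := (x :+ a :* y) :+ b :* (y :+ a :* z))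
        refl a b (p k) (p (suc k)) (p (suc (suc k)))

linearTimes-degree : ∀ c {n p} → DegreeAtMost n p → DegreeAtMost (suc n) (linearTimes c p)
linearTimes-degree c {p = p} deg (suc k) (s≤s n<k) = begin
  p k +ℚ c * p (suc k) ≡⟨ cong₂ (λ a b → a +ℚ c * b) (deg k n<k) (deg (suc k) (ℕ.m<n⇒m<1+n n<k)) ⟩
  0ℚ +ℚ c * 0ℚ         ≡⟨ solve 1 (λ c → con 0ℚ :+ c :* con 0ℚ := con 0ℚ) refl c ⟩
  0ℚ                   ∎

taylorShift-extend : ∀ {N p} → DegreeAtMost N p → ∀ {M} → N ≤ M → ∀ k →
                     taylorShift M p k ≡ taylorShift N p k
taylorShift-extend deg N≤M k =
  sumTo-extend _ N≤M λ m N<m → trans (cong (_* ℕtoℚ (m C k)) (deg m N<m)) (*-zeroˡ (ℕtoℚ (m C k)))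

taylorShift-linear : ∀ N c p q k →
  taylorShift N (λ m → p m +ℚ c * q m) k ≡ taylorShift N p k +ℚ c * taylorShift N q k
taylorShift-linear N c p q k = sumTo-linear N c p q (λ m → ℕtoℚ (m C k))

taylorShift-timesX : ∀ N p k →
  taylorShift (suc N) (timesX p) k ≡ timesX (taylorShift N p) k +ℚ taylorShift N p k
taylorShift-timesX N p zero    = sumTo-suc N _
taylorShift-timesX N p (suc j) = begin
  taylorShift (suc N) (timesX p) (suc j)
    ≡⟨ sumTo-suc N _ ⟩
  0ℚ +ℚ sumTo N (λ m → p m * ℕtoℚ (suc m C suc j))
    ≡⟨ +-identityˡ _ ⟩
  sumTo N (λ m → p m * ℕtoℚ (suc m C suc j))
    ≡⟨ sumTo-cong N (λ m _ → cong (p m *_) pascal) ⟩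
  sumTo N (λ m → p m * (ℕtoℚ (m C j) +ℚ ℕtoℚ (m C suc j)))
    ≡⟨ sumTo-cong N (λ m _ → *-distribˡ-+ (p m) _ _) ⟩
  sumTo N (λ m → p m * ℕtoℚ (m C j) +ℚ p m * ℕtoℚ (m C suc j))
    ≡⟨ sumTo-+ N _ _ ⟩
  taylorShift N p j +ℚ taylorShift N p (suc j) ∎
  where
  pascal : ∀ {m} → ℕtoℚ (suc m C suc j) ≡ ℕtoℚ (m C j) +ℚ ℕtoℚ (m C suc j)
  pascal {m} = trans (cong ℕtoℚ (sym (nCk+nC[k+1]≡[n+1]C[k+1] m j))) (ℕtoℚ-+ (m C j) (m C suc j))

taylorShift-linearTimes : ∀ c {N p} → DegreeAtMost N p → ∀ k →
  taylorShift (suc N) (linearTimes c p) k ≡ linearTimes (c +ℚ 1ℚ) (taylorShift N p) k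
taylorShift-linearTimes c {N} {p} deg k = begin
  taylorShift (suc N) (linearTimes c p) k
    ≡⟨ sumTo-cong (suc N) (λ m _ → cong (_* ℕtoℚ (m C k)) (linearTimes-split c p m)) ⟩
  taylorShift (suc N) (λ m → timesX p m +ℚ c * p m) k
    ≡⟨ taylorShift-linear (suc N) c (timesX p) p k ⟩
  taylorShift (suc N) (timesX p) k +ℚ c * taylorShift (suc N) p k
    ≡⟨ cong₂ (λ a b → a +ℚ c * b) (taylorShift-timesX N p k) (taylorShift-extend deg (ℕ.n≤1+n N) k) ⟩
  (timesX q k +ℚ q k) +ℚ c * q k
    ≡⟨ solve 3 (λ t x c → (t :+ x) :+ c :* x := t :+ (c :+ con 1ℚ) :* x) refl (timesX q k) (q k) c ⟩
  timesX q k +ℚ (c +ℚ 1ℚ) * q k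
    ≡⟨ sym (linearTimes-split (c +ℚ 1ℚ) q k) ⟩
  linearTimes (c +ℚ 1ℚ) q k ∎
  where q = taylorShift N p

eulerFunctional-cong : ∀ N {p q} → (∀ k → p k ≡ q k) → eulerFunctional N p ≡ eulerFunctional N q
eulerFunctional-cong N p≗q = sumTo-cong N λ k _ → cong (_* E k) (p≗q k)

eulerFunctional-extend : ∀ {n p} → DegreeAtMost n p → ∀ {N} → n ≤ N →
                         eulerFunctional N p ≡ eulerFunctional n p
eulerFunctional-extend deg n≤N =
  sumTo-extend _ n≤N λ k n<k → trans (cong (_* E k) (deg k n<k)) (*-zeroˡ (E k))

eulerFunctional-linear : ∀ N c p q →
  eulerFunctional N (λ k → p k +ℚ c * q k) ≡ eulerFunctional N p +ℚ c * eulerFunctional N q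
eulerFunctional-linear N c p q = sumTo-linear N c p q E

E-binomial-extend : ∀ {m N} → m ≤ N → sumTo N (λ k → ℕtoℚ (m C k) * E k) +ℚ E m ≡ twoIfZero m
E-binomial-extend {m} m≤N = trans (cong (_+ℚ E m) (sumTo-extend _ m≤N vanish)) (E-binomial m)
  where
  vanish : ∀ k → m < k → ℕtoℚ (m C k) * E k ≡ 0ℚ
  vanish k m<k = trans (cong (λ c → ℕtoℚ c * E k) (k>n⇒nCk≡0 m<k)) (*-zeroˡ (E k))

eulerFunctional-taylorShift : ∀ N p →
  eulerFunctional N (taylorShift N p) +ℚ eulerFunctional N p ≡ p 0 +ℚ p 0
eulerFunctional-taylorShift N p = begin
  eulerFunctional N (taylorShift N p) +ℚ eulerFunctional N p
    ≡⟨ cong (_+ℚ eulerFunctional N p) expand ⟩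
  sumTo N (λ m → p m * B m) +ℚ sumTo N (λ m → p m * E m)
    ≡⟨ sym (sumTo-+ N _ _) ⟩
  sumTo N (λ m → p m * B m +ℚ p m * E m)
    ≡⟨ sumTo-cong N (λ m m≤N → trans (sym (*-distribˡ-+ (p m) (B m) (E m)))
                                     (cong (p m *_) (E-binomial-extend m≤N))) ⟩
  sumTo N (λ m → p m * twoIfZero m)
    ≡⟨ sumTo-twoIfZero N p ⟩
  p 0 +ℚ p 0 ∎
  where
  B : ℕ → ℚ
  B m = sumTo N (λ k → ℕtoℚ (m C k) * E k)
  expand : eulerFunctional N (taylorShift N p) ≡ sumTo N (λ m → p m * B m)
  expand = begin
    sumTo N (λ k → sumTo N (λ m → p m * ℕtoℚ (m C k)) * E k)
      ≡⟨ sumTo-cong N (λ k _ → sumTo-*ʳ N (E k) _) ⟩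
    sumTo N (λ k → sumTo N (λ m → p m * ℕtoℚ (m C k) * E k))
      ≡⟨ sumTo-swap N N _ ⟩
    sumTo N (λ m → sumTo N (λ k → p m * ℕtoℚ (m C k) * E k))
      ≡⟨ sumTo-cong N (λ m _ → sumTo-cong N (λ k _ → *-assoc (p m) (ℕtoℚ (m C k)) (E k))) ⟩
    sumTo N (λ m → sumTo N (λ k → p m * (ℕtoℚ (m C k) * E k)))
      ≡⟨ sumTo-cong N (λ m _ → sym (sumTo-*ˡ N (p m) _)) ⟩
    sumTo N (λ m → p m * B m) ∎

fallingFactorial : ℚ → ℕ → Poly
fallingFactorial c zero    = one
fallingFactorial c (suc n) = linearTimes c (fallingFactorial (c -ℚ 1ℚ) n)

fallingFactorial-degree : ∀ c n → DegreeAtMost n (fallingFactorial c n)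
fallingFactorial-degree c zero    (suc k) _ = refl
fallingFactorial-degree c (suc n) = linearTimes-degree c (fallingFactorial-degree (c -ℚ 1ℚ) n)

fallingFactorial-cong : ∀ {c d} n → c ≡ d → ∀ k → fallingFactorial c n k ≡ fallingFactorial d n k
fallingFactorial-cong n refl k = refl

fallingFactorial-last : ∀ c n k →
  fallingFactorial c (suc n) k ≡ linearTimes (c -ℚ ℕtoℚ n) (fallingFactorial c n) k
fallingFactorial-last c zero    k = cong (λ d → linearTimes d one k) (sym (+-identityʳ c))
fallingFactorial-last c (suc n) k = begin
  linearTimes c (fallingFactorial (c -ℚ 1ℚ) (suc n)) k
    ≡⟨ linearTimes-cong c (fallingFactorial-last (c -ℚ 1ℚ) n) k ⟩
  linearTimes c (linearTimes (c -ℚ 1ℚ -ℚ ℕtoℚ n) (fallingFactorial (c -ℚ 1ℚ) n)) k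
    ≡⟨ linearTimes-comm c _ _ k ⟩
  linearTimes (c -ℚ 1ℚ -ℚ ℕtoℚ n) (fallingFactorial c (suc n)) k
    ≡⟨ cong (λ d → linearTimes d (fallingFactorial c (suc n)) k) c-1-n≡c-[1+n] ⟩
  linearTimes (c -ℚ ℕtoℚ (suc n)) (fallingFactorial c (suc n)) k ∎
  where
  c-1-n≡c-[1+n] : c -ℚ 1ℚ -ℚ ℕtoℚ n ≡ c -ℚ ℕtoℚ (suc n)
  c-1-n≡c-[1+n] = trans (solve 2 (λ c n → c :- con 1ℚ :- n := c :- (con 1ℚ :+ n)) refl c (ℕtoℚ n))
                        (cong (c -ℚ_) (sym (ℕtoℚ-suc n)))

fallingFactorial-difference : ∀ c n k →
  fallingFactorial (c +ℚ 1ℚ) (suc n) k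
    ≡ fallingFactorial c (suc n) k +ℚ ℕtoℚ (suc n) * fallingFactorial c n k
fallingFactorial-difference c n k = begin
  linearTimes (c +ℚ 1ℚ) (fallingFactorial (c +ℚ 1ℚ -ℚ 1ℚ) n) k
    ≡⟨ linearTimes-cong (c +ℚ 1ℚ) (fallingFactorial-cong n c+1-1≡c) k ⟩
  linearTimes (c +ℚ 1ℚ) (fallingFactorial c n) k
    ≡⟨ cong (λ d → linearTimes d (fallingFactorial c n) k) c+1≡c-n+[1+n] ⟩
  linearTimes (c -ℚ ℕtoℚ n +ℚ ℕtoℚ (suc n)) (fallingFactorial c n) k
    ≡⟨ linearTimes-+ (c -ℚ ℕtoℚ n) (ℕtoℚ (suc n)) (fallingFactorial c n) k ⟩
  linearTimes (c -ℚ ℕtoℚ n) (fallingFactorial c n) k +ℚ ℕtoℚ (suc n) * fallingFactorial c n k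
    ≡⟨ cong (_+ℚ ℕtoℚ (suc n) * fallingFactorial c n k) (sym (fallingFactorial-last c n k)) ⟩
  fallingFactorial c (suc n) k +ℚ ℕtoℚ (suc n) * fallingFactorial c n k ∎
  where
  c+1-1≡c : c +ℚ 1ℚ -ℚ 1ℚ ≡ c
  c+1-1≡c = solve 1 (λ c → c :+ con 1ℚ :- con 1ℚ := c) refl c
  c+1≡c-n+[1+n] : c +ℚ 1ℚ ≡ c -ℚ ℕtoℚ n +ℚ ℕtoℚ (suc n)
  c+1≡c-n+[1+n] = trans (solve 2 (λ c n → c :+ con 1ℚ := c :- n :+ (con 1ℚ :+ n)) refl c (ℕtoℚ n))
                        (cong (c -ℚ ℕtoℚ n +ℚ_) (sym (ℕtoℚ-suc n)))

taylorShift-fallingFactorial : ∀ c n k →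
  taylorShift n (fallingFactorial c n) k ≡ fallingFactorial (c +ℚ 1ℚ) n k
taylorShift-fallingFactorial c zero    zero    = refl
taylorShift-fallingFactorial c zero    (suc k) = refl
taylorShift-fallingFactorial c (suc n) k = begin
  taylorShift (suc n) (linearTimes c (fallingFactorial (c -ℚ 1ℚ) n)) k
    ≡⟨ taylorShift-linearTimes c (fallingFactorial-degree (c -ℚ 1ℚ) n) k ⟩
  linearTimes (c +ℚ 1ℚ) (taylorShift n (fallingFactorial (c -ℚ 1ℚ) n)) k
    ≡⟨ linearTimes-cong (c +ℚ 1ℚ) shifted k ⟩
  linearTimes (c +ℚ 1ℚ) (fallingFactorial (c +ℚ 1ℚ -ℚ 1ℚ) n) k ∎
  where
  c-1+1≡c+1-1 : c -ℚ 1ℚ +ℚ 1ℚ ≡ c +ℚ 1ℚ -ℚ 1ℚ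
  c-1+1≡c+1-1 = solve 1 (λ c → c :- con 1ℚ :+ con 1ℚ := c :+ con 1ℚ :- con 1ℚ) refl c
  shifted : ∀ i → taylorShift n (fallingFactorial (c -ℚ 1ℚ) n) i ≡ fallingFactorial (c +ℚ 1ℚ -ℚ 1ℚ) n i
  shifted i = trans (taylorShift-fallingFactorial (c -ℚ 1ℚ) n i) (fallingFactorial-cong n c-1+1≡c+1-1 i)

fallingFactorial-root : ∀ j n → j < n → fallingFactorial (ℕtoℚ j) n 0 ≡ 0ℚ
fallingFactorial-root zero    (suc n) _ = *-zeroˡ (fallingFactorial (0ℚ -ℚ 1ℚ) n 0)
fallingFactorial-root (suc j) (suc n) (s≤s j<n) = begin
  ℕtoℚ (suc j) * fallingFactorial (ℕtoℚ (suc j) -ℚ 1ℚ) n 0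
    ≡⟨ cong (ℕtoℚ (suc j) *_) (fallingFactorial-cong n (ℕtoℚ-suc-1 j) 0) ⟩
  ℕtoℚ (suc j) * fallingFactorial (ℕtoℚ j) n 0
    ≡⟨ cong (ℕtoℚ (suc j) *_) (fallingFactorial-root j n j<n) ⟩
  ℕtoℚ (suc j) * 0ℚ
    ≡⟨ *-zeroʳ (ℕtoℚ (suc j)) ⟩
  0ℚ ∎

eulerFalling : ℚ → ℕ → ℚ
eulerFalling c n = eulerFunctional n (fallingFactorial c n)

eulerFalling-shift : ∀ c n →
  eulerFalling (c +ℚ 1ℚ) n +ℚ eulerFalling c n ≡ fallingFactorial c n 0 +ℚ fallingFactorial c n 0
eulerFalling-shift c n =
  trans (cong (_+ℚ eulerFalling c n) (eulerFunctional-cong n (sym ∘ taylorShift-fallingFactorial c n)))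
        (eulerFunctional-taylorShift n (fallingFactorial c n))

eulerFalling-difference : ∀ c n →
  eulerFalling (c +ℚ 1ℚ) (suc n) ≡ eulerFalling c (suc n) +ℚ ℕtoℚ (suc n) * eulerFalling c n
eulerFalling-difference c n = begin
  eulerFunctional (suc n) (fallingFactorial (c +ℚ 1ℚ) (suc n))
    ≡⟨ eulerFunctional-cong (suc n) (fallingFactorial-difference c n) ⟩
  eulerFunctional (suc n) (λ k → fallingFactorial c (suc n) k +ℚ ℕtoℚ (suc n) * fallingFactorial c n k)
    ≡⟨ eulerFunctional-linear (suc n) (ℕtoℚ (suc n)) (fallingFactorial c (suc n)) (fallingFactorial c n) ⟩
  eulerFalling c (suc n) +ℚ ℕtoℚ (suc n) * eulerFunctional (suc n) (fallingFactorial c n)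
    ≡⟨ cong (λ w → eulerFalling c (suc n) +ℚ ℕtoℚ (suc n) * w)
            (eulerFunctional-extend (fallingFactorial-degree c n) (ℕ.n≤1+n n)) ⟩
  eulerFalling c (suc n) +ℚ ℕtoℚ (suc n) * eulerFalling c n ∎

eulerFalling-zero : ∀ n → eulerFalling 0ℚ n ≡ sgn n * ℕtoℚ (n !) * (½ ^ℚ n)
eulerFalling-zero zero    = refl
eulerFalling-zero (suc n) = begin
  eulerFalling 0ℚ (suc n)
    ≡⟨ halve shift (eulerFalling-difference 0ℚ n) ⟩
  - ½ * (ℕtoℚ (suc n) * eulerFalling 0ℚ n)
    ≡⟨ cong (λ w → - ½ * (ℕtoℚ (suc n) * w)) (eulerFalling-zero n) ⟩
  - ½ * (ℕtoℚ (suc n) * (sgn n * ℕtoℚ (n !) * (½ ^ℚ n)))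
    ≡⟨ solve 4 (λ m s f h → :- con ½ :* (m :* (s :* f :* h))
                          := (:- con 1ℚ :* s) :* (m :* f) :* (con ½ :* h))
             refl (ℕtoℚ (suc n)) (sgn n) (ℕtoℚ (n !)) (½ ^ℚ n) ⟩
  sgn (suc n) * (ℕtoℚ (suc n) * ℕtoℚ (n !)) * (½ ^ℚ suc n)
    ≡⟨ cong (λ f → sgn (suc n) * f * (½ ^ℚ suc n)) (sym (ℕtoℚ-* (suc n) (n !))) ⟩
  sgn (suc n) * ℕtoℚ (suc n !) * (½ ^ℚ suc n) ∎
  where
  shift : eulerFalling 1ℚ (suc n) +ℚ eulerFalling 0ℚ (suc n) ≡ 0ℚ +ℚ 0ℚ
  shift = trans (eulerFalling-shift 0ℚ (suc n))
                (cong (λ x → x +ℚ x) (fallingFactorial-root 0 (suc n) (s≤s z≤n)))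
  halve : ∀ {a b d} → a +ℚ b ≡ 0ℚ +ℚ 0ℚ → a ≡ b +ℚ d → b ≡ - ½ * d
  halve {a} {b} {d} a+b≡0 a≡b+d = begin
    b
      ≡⟨ solve 2 (λ a b → b := con ½ :* (a :+ b) :- con ½ :* (a :- b)) refl a b ⟩
    ½ * (a +ℚ b) -ℚ ½ * (a -ℚ b)
      ≡⟨ cong₂ (λ s a → ½ * s -ℚ ½ * (a -ℚ b)) a+b≡0 a≡b+d ⟩
    ½ * (0ℚ +ℚ 0ℚ) -ℚ ½ * (b +ℚ d -ℚ b)
      ≡⟨ solve 2 (λ b d → con ½ :* (con 0ℚ :+ con 0ℚ) :- con ½ :* (b :+ d :- b) := :- con ½ :* d)
               refl b d ⟩
    - ½ * d ∎

eulerFalling-alternate : ∀ j n → j < n → eulerFalling (ℕtoℚ (suc j)) n ≡ - eulerFalling (ℕtoℚ j) n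
eulerFalling-alternate j n j<n = inverseˡ-unique _ _ (begin
  eulerFalling (ℕtoℚ (suc j)) n +ℚ eulerFalling (ℕtoℚ j) n
    ≡⟨ cong (λ c → eulerFalling c n +ℚ eulerFalling (ℕtoℚ j) n)
            (trans (ℕtoℚ-suc j) (+-comm 1ℚ (ℕtoℚ j))) ⟩
  eulerFalling (ℕtoℚ j +ℚ 1ℚ) n +ℚ eulerFalling (ℕtoℚ j) n
    ≡⟨ eulerFalling-shift (ℕtoℚ j) n ⟩
  fallingFactorial (ℕtoℚ j) n 0 +ℚ fallingFactorial (ℕtoℚ j) n 0
    ≡⟨ cong (λ x → x +ℚ x) (fallingFactorial-root j n j<n) ⟩
  0ℚ +ℚ 0ℚ ∎)

eulerFalling-ℕ : ∀ n j → j ≤ n → eulerFalling (ℕtoℚ j) n ≡ sgn j * eulerFalling 0ℚ n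
eulerFalling-ℕ n zero    _   = sym (*-identityˡ (eulerFalling 0ℚ n))
eulerFalling-ℕ n (suc j) j<n = begin
  eulerFalling (ℕtoℚ (suc j)) n
    ≡⟨ eulerFalling-alternate j n j<n ⟩
  - eulerFalling (ℕtoℚ j) n
    ≡⟨ cong -_ (eulerFalling-ℕ n j (ℕ.<⇒≤ j<n)) ⟩
  - (sgn j * eulerFalling 0ℚ n)
    ≡⟨ solve 2 (λ s w → :- (s :* w) := (:- con 1ℚ :* s) :* w) refl (sgn j) (eulerFalling 0ℚ n) ⟩
  sgn (suc j) * eulerFalling 0ℚ n ∎

-- The Stirling side and the binomial side

-- The unsigned Stirling numbers are the coefficients of x(x + 1) ⋯ (x + n - 1) = (x + n - 1)ₙ.
S₁-rising : ∀ n m → sgn (m + n) * ℤtoℚ (S₁ n m) ≡ fallingFactorial (ℕtoℚ n -ℚ 1ℚ) n m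
S₁-rising zero    zero    = refl
S₁-rising zero    (suc m) = *-zeroʳ (sgn (suc m + 0))
S₁-rising (suc n) zero    = begin
  sgn (suc n) * 0ℚ
    ≡⟨ *-zeroʳ (sgn (suc n)) ⟩
  0ℚ
    ≡⟨ fallingFactorial-root n (suc n) ℕ.≤-refl ⟨
  fallingFactorial (ℕtoℚ n) (suc n) 0
    ≡⟨ fallingFactorial-cong (suc n) (ℕtoℚ-suc-1 n) 0 ⟨
  fallingFactorial (ℕtoℚ (suc n) -ℚ 1ℚ) (suc n) 0 ∎
S₁-rising (suc n) (suc m) = begin
  sgn (suc m + suc n) * ℤtoℚ (S₁ n m ℤ.- + n ℤ.* S₁ n (suc m))
    ≡⟨ cong₂ _*_ (cong (λ k → - 1ℚ * sgn k) (ℕ.+-suc m n)) cast ⟩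
  - 1ℚ * (- 1ℚ * s) * (x +ℚ - (ℕtoℚ n * y))
    ≡⟨ solve 4 (λ s x n y → :- con 1ℚ :* (:- con 1ℚ :* s) :* (x :+ :- (n :* y))
                          := s :* x :+ n :* (:- con 1ℚ :* s :* y)) refl s x (ℕtoℚ n) y ⟩
  s * x +ℚ ℕtoℚ n * (sgn (suc m + n) * y)
    ≡⟨ cong₂ (λ a b → a +ℚ ℕtoℚ n * b) (S₁-rising n m) (S₁-rising n (suc m)) ⟩
  linearTimes (ℕtoℚ n) (fallingFactorial (ℕtoℚ n -ℚ 1ℚ) n) (suc m)
    ≡⟨ fallingFactorial-cong (suc n) (sym (ℕtoℚ-suc-1 n)) (suc m) ⟩
  fallingFactorial (ℕtoℚ (suc n) -ℚ 1ℚ) (suc n) (suc m) ∎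
  where
  s = sgn (m + n)
  x = ℤtoℚ (S₁ n m)
  y = ℤtoℚ (S₁ n (suc m))
  cast : ℤtoℚ (S₁ n m ℤ.- + n ℤ.* S₁ n (suc m)) ≡ x +ℚ - (ℕtoℚ n * y)
  cast = trans (ℤtoℚ-+ (S₁ n m) _)
               (cong (x +ℚ_) (trans (ℤtoℚ-neg (+ n ℤ.* S₁ n (suc m)))
                                    (cong -_ (ℤtoℚ-* (+ n) (S₁ n (suc m))))))

sgn²≡1 : ∀ n → sgn n * sgn n ≡ 1ℚ
sgn²≡1 zero    = refl
sgn²≡1 (suc n) =
  trans (solve 1 (λ s → (:- con 1ℚ :* s) :* (:- con 1ℚ :* s) := s :* s) refl (sgn n)) (sgn²≡1 n)

neg-^ℚ : ∀ q n → (- q) ^ℚ n ≡ sgn n * (q ^ℚ n)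
neg-^ℚ q zero    = refl
neg-^ℚ q (suc n) = trans (cong (- q *_) (neg-^ℚ q n))
  (solve 3 (λ q s h → :- q :* (s :* h) := (:- con 1ℚ :* s) :* (q :* h)) refl q (sgn n) (q ^ℚ n))

^ℚ≡^ : ∀ q n → q ^ℚ n ≡ q ^ n
^ℚ≡^ q zero    = refl
^ℚ≡^ q (suc n) = cong (q *_) (^ℚ≡^ q n)

×≡ℕtoℚ* : ∀ n q → n × q ≡ ℕtoℚ n * q
×≡ℕtoℚ* zero    q = sym (*-zeroˡ q)
×≡ℕtoℚ* (suc n) q = begin
  q +ℚ n × q           ≡⟨ cong (q +ℚ_) (×≡ℕtoℚ* n q) ⟩
  q +ℚ ℕtoℚ n * q      ≡⟨ solve 2 (λ q n → q :+ n :* q := (con 1ℚ :+ n) :* q) refl q (ℕtoℚ n) ⟩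
  (1ℚ +ℚ ℕtoℚ n) * q   ≡⟨ cong (_* q) (ℕtoℚ-suc n) ⟨
  ℕtoℚ (suc n) * q     ∎

1^≡1 : ∀ n → 1ℚ ^ n ≡ 1ℚ
1^≡1 zero    = refl
1^≡1 (suc n) = trans (*-identityˡ (1ℚ ^ n)) (1^≡1 n)

binomial : ∀ k x → sumTo k (λ j → ℕtoℚ (k C j) * (x ^ℚ j)) ≡ (x +ℚ 1ℚ) ^ℚ k
binomial k x = begin
  sumTo k (λ j → ℕtoℚ (k C j) * (x ^ℚ j))                     ≡⟨ sumTo≡∑ k _ ⟩
  ∑[ i ≤ k ] (ℕtoℚ (k C toℕ i) * (x ^ℚ toℕ i))                ≡⟨ sum-cong-≗ {suc k} term ⟩
  ∑[ i ≤ k ] ((k C toℕ i) × (x ^ toℕ i * 1ℚ ^ (k ∸ toℕ i)))   ≡⟨ binomialTheorem k x 1ℚ ⟨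
  (x +ℚ 1ℚ) ^ k                                               ≡⟨ ^ℚ≡^ (x +ℚ 1ℚ) k ⟨
  (x +ℚ 1ℚ) ^ℚ k                                              ∎
  where
  term : ∀ i → ℕtoℚ (k C toℕ i) * (x ^ℚ toℕ i) ≡ (k C toℕ i) × (x ^ toℕ i * 1ℚ ^ (k ∸ toℕ i))
  term i = begin
    ℕtoℚ (k C toℕ i) * (x ^ℚ toℕ i)
      ≡⟨ cong (ℕtoℚ (k C toℕ i) *_) (^ℚ≡^ x (toℕ i)) ⟩
    ℕtoℚ (k C toℕ i) * (x ^ toℕ i)
      ≡⟨ cong (ℕtoℚ (k C toℕ i) *_) (trans (cong (x ^ toℕ i *_) (1^≡1 (k ∸ toℕ i))) (*-identityʳ _)) ⟨
    ℕtoℚ (k C toℕ i) * (x ^ toℕ i * 1ℚ ^ (k ∸ toℕ i))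
      ≡⟨ ×≡ℕtoℚ* (k C toℕ i) _ ⟨
    (k C toℕ i) × (x ^ toℕ i * 1ℚ ^ (k ∸ toℕ i)) ∎

alternating-binomial-sum : ∀ k →
  sumTo (suc k) (λ m → sgn m * ℕtoℚ (k C (suc k ∸ m)) * ℕtoℚ (suc k !) * (½ ^ℚ m))
    ≡ - (ℕtoℚ (suc k !) * (½ ^ℚ suc k))
alternating-binomial-sum k = begin
  sumTo (suc k) (λ m → sgn m * ℕtoℚ (k C (suc k ∸ m)) * F * (½ ^ℚ m))
    ≡⟨ sumTo-suc k _ ⟩
  1ℚ * ℕtoℚ (k C suc k) * F * 1ℚ
    +ℚ sumTo k (λ j → sgn (suc j) * ℕtoℚ (k C (k ∸ j)) * F * (½ ^ℚ suc j))
    ≡⟨ cong₂ _+ℚ_ first (sumTo-cong k term) ⟩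
  0ℚ +ℚ sumTo k (λ j → - ½ * F * (ℕtoℚ (k C j) * (- ½) ^ℚ j))
    ≡⟨ +-identityˡ _ ⟩
  sumTo k (λ j → - ½ * F * (ℕtoℚ (k C j) * (- ½) ^ℚ j))
    ≡⟨ sumTo-*ˡ k (- ½ * F) _ ⟨
  - ½ * F * sumTo k (λ j → ℕtoℚ (k C j) * (- ½) ^ℚ j)
    ≡⟨ cong (- ½ * F *_) (binomial k (- ½)) ⟩
  - ½ * F * (½ ^ℚ k)
    ≡⟨ solve 2 (λ f h → :- con ½ :* f :* h := :- (f :* (con ½ :* h))) refl F (½ ^ℚ k) ⟩
  - (F * (½ ^ℚ suc k)) ∎
  where
  F = ℕtoℚ (suc k !)
  first : 1ℚ * ℕtoℚ (k C suc k) * F * 1ℚ ≡ 0ℚ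
  first = trans (cong (λ c → 1ℚ * ℕtoℚ c * F * 1ℚ) (k>n⇒nCk≡0 (ℕ.n<1+n k)))
                (solve 1 (λ f → con 1ℚ :* con 0ℚ :* f :* con 1ℚ := con 0ℚ) refl F)
  term : ∀ j → j ≤ k →
         sgn (suc j) * ℕtoℚ (k C (k ∸ j)) * F * (½ ^ℚ suc j) ≡ - ½ * F * (ℕtoℚ (k C j) * (- ½) ^ℚ j)
  term j j≤k = begin
    sgn (suc j) * ℕtoℚ (k C (k ∸ j)) * F * (½ ^ℚ suc j)
      ≡⟨ cong (λ c → sgn (suc j) * ℕtoℚ c * F * (½ ^ℚ suc j)) (nCk≡nC[n∸k] j≤k) ⟨
    sgn (suc j) * ℕtoℚ (k C j) * F * (½ ^ℚ suc j)
      ≡⟨ solve 4 (λ s c f h → (:- con 1ℚ :* s) :* c :* f :* (con ½ :* h)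
                            := :- con ½ :* f :* (c :* (s :* h))) refl (sgn j) (ℕtoℚ (k C j)) F (½ ^ℚ j) ⟩
    - ½ * F * (ℕtoℚ (k C j) * (sgn j * ½ ^ℚ j))
      ≡⟨ cong (λ y → - ½ * F * (ℕtoℚ (k C j) * y)) (neg-^ℚ ½ j) ⟨
    - ½ * F * (ℕtoℚ (k C j) * (- ½) ^ℚ j) ∎

stirling-euler-sum : ∀ k →
  sumTo (suc (suc k)) (λ m → sgn (m + suc k) * ℤtoℚ (S₁ (suc k) m) * E m)
    ≡ - (ℕtoℚ (suc k !) * (½ ^ℚ suc k))
stirling-euler-sum k = begin
  eulerFunctional (suc n) (λ m → sgn (m + n) * ℤtoℚ (S₁ n m))
    ≡⟨ eulerFunctional-cong (suc n) (S₁-rising n) ⟩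
  eulerFunctional (suc n) (fallingFactorial (ℕtoℚ n -ℚ 1ℚ) n)
    ≡⟨ eulerFunctional-extend (fallingFactorial-degree (ℕtoℚ n -ℚ 1ℚ) n) (ℕ.n≤1+n n) ⟩
  eulerFalling (ℕtoℚ n -ℚ 1ℚ) n
    ≡⟨ cong (λ c → eulerFalling c n) (ℕtoℚ-suc-1 k) ⟩
  eulerFalling (ℕtoℚ k) n
    ≡⟨ eulerFalling-ℕ n k (ℕ.n≤1+n k) ⟩
  sgn k * eulerFalling 0ℚ n
    ≡⟨ cong (sgn k *_) (eulerFalling-zero n) ⟩
  sgn k * (sgn n * F * (½ ^ℚ n))
    ≡⟨ solve 3 (λ s f h → s :* ((:- con 1ℚ :* s) :* f :* h) := :- ((s :* s) :* (f :* h)))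
             refl (sgn k) F (½ ^ℚ n) ⟩
  - (sgn k * sgn k * (F * (½ ^ℚ n)))
    ≡⟨ cong (λ s → - (s * (F * (½ ^ℚ n)))) (sgn²≡1 k) ⟩
  - (1ℚ * (F * (½ ^ℚ n)))
    ≡⟨ cong -_ (*-identityˡ _) ⟩
  - (F * (½ ^ℚ n)) ∎
  where
  n = suc k
  F = ℕtoℚ (n !)

mainTheorem20 : (n : ℕ) → .{{_ : NonZero n}} →
    sumTo n (λ m → sgn m * ℕtoℚ ((n ∸ 1) C (n ∸ m)) * ℕtoℚ (n !) * (((+ 1) / 2) ^ℚ m))
      ≡ sumTo (suc n) (λ m → sgn (m + n) * ℤtoℚ (S₁ n m) * E m)
mainTheorem20 (suc k) = trans (alternating-binomial-sum k) (sym (stirling-euler-sum k))
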